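{- Let $X$ be a real normed space, let $n \geq 1$, let $m \geq 2$ be an even integer, and let $f \colon \{ -1,1\}^{n} \to X$ be a function such that $\widehat{f}(S) = 0$ for every $S \subset \{1,\ldots,n\}$ with $|S| > \frac{n}{m} - \frac{1}{2}$ (i.e. $\deg(f) \leq \frac{n}{m}-\frac12$). If $f(x) = 0$ for all $x \in W(m)$, then $f \equiv 0$ on $\{ -1,1\}^{n}$.
   Context: Every function $f\colon \{ -1,1\}^{n} \to X$ has a unique Fourier–Walsh representation $f(x) = \sum_{S \subset \{1,\ldots,n\}} \widehat{f}(S) x^{S}$ with $\widehat{f}(S) \in X$, where $x^{S} = \prod_{j \in S} x_{j}$ and $x^{\emptyset} = 1$; the degree of $f$ is the largest $|S|$ with $\widehat f(S)\neq 0$. For an integer $m > 1$, $W(m)$ denotes the set of points $x \in \{ -1,1\}^{n}$ such that $\#\{j : x_{j} = -1\}$ is divisible by $m$. -}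

module Defs where

open import Level using (Level)
open import Data.Bool using (Bool; true; false)
open import Data.Nat using (ℕ; zero; suc)
open import Data.Nat.Divisibility using (_∣_)
open import Data.Sign as Sg using (Sign)
open import Data.Vec using (Vec; []; _∷_)
open import Data.Product using (Σ; _×_; ∃)
open import Relation.Nullary using (¬_)
open import Algebra.Bundles using (CommutativeRing)
open import Algebra.Module.Bundles using (LeftModule)

private variable r ℓr m ℓm : Level

Cube : ℕ → Set
Cube n = Vec Sign n

-- Subsets of {1,…,n} as characteristic vectors.
Sub : ℕ → Set
Sub n = Vec Bool n

card : ∀ {n} → Sub n → ℕ
card [] = 0
card (true ∷ S) = suc (card S)
card (false ∷ S) = card S

minusCount : ∀ {n} → Cube n → ℕ
minusCount [] = 0
minusCount (Sg.- ∷ x) = suc (minusCount x)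
minusCount (Sg.+ ∷ x) = minusCount x

InW : ∀ {n} → ℕ → Cube n → Set
InW m x = m ∣ minusCount x

module _ (R : CommutativeRing r ℓr) where
  open CommutativeRing R

  natCast : ℕ → Carrier
  natCast zero = 0#
  natCast (suc k) = 1# + natCast k

  IsField : Set (r Level.⊔ ℓr)
  IsField = ¬ (1# ≈ 0#) × (∀ a → ¬ (a ≈ 0#) → ∃ λ b → a * b ≈ 1#)

  CharZero : Set ℓr
  CharZero = ∀ k → ¬ (natCast (suc k) ≈ 0#)

  chi : ∀ {n} → Cube n → Sub n → Carrier
  chi [] [] = 1#
  chi (_ ∷ x) (false ∷ S) = chi x S
  chi (Sg.+ ∷ x) (true ∷ S) = chi x S
  chi (Sg.- ∷ x) (true ∷ S) = - (chi x S)

module _ (R : CommutativeRing r ℓr) (X : LeftModule (CommutativeRing.ring R) m ℓm) where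
  open CommutativeRing R using (Carrier)
  open LeftModule X

  sumSub : ∀ {n} → (Sub n → Carrierᴹ) → Carrierᴹ
  sumSub {zero} g = g []
  sumSub {suc n} g = sumSub (λ S → g (false ∷ S)) +ᴹ sumSub (λ S → g (true ∷ S))

  IsFourierWalsh : ∀ {n} → (Cube n → Carrierᴹ) → (Sub n → Carrierᴹ) → Set ℓm
  IsFourierWalsh f c = ∀ x → f x ≈ᴹ sumSub (λ S → chi R x S *ₗ c S)

module Submission where

-- Let f have degree ≤ d and vanish on W(k), with d k < n.  Flipping a block of k coordinates
-- from all + to all − changes the number of minus signs by k, so the difference of the two
-- restrictions of f has degree < d on n − k coordinates and vanishes on W(k); by induction on
-- d it is 0.  Thus f ∘ π is invariant under this block flip for every coordinate permutation π.
-- Such an f is constant once d + k ≤ n: by induction on d every discrete derivative of f ∘ π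
-- is a constant a, the same in every coordinate, and telescoping a block flip through k
-- single flips gives k a = 0, so a = 0 in characteristic zero.  The constant is
-- f (1,…,1) = 0 since (1,…,1) ∈ W(k).

open import Defs
open import Data.Nat using (ℕ; _+_; _*_; _<_; _≤_)
open import Data.Nat.Divisibility using (_∣_)
open import Data.Product using (_×_; ∃)
open import Algebra.Bundles using (CommutativeRing)
open import Algebra.Module.Bundles using (LeftModule)

open import Level using (_⊔_)
open import Function using (id; _∘_)
open import Data.Bool using (true; false)
open import Data.Nat using (zero; suc; z≤n; s≤s; z<s)
open import Data.Nat.Properties as ℕ using ()
open import Data.Nat.Solver using (module +-*-Solver)
open import Data.Nat.DivMod using (_/_; m%n<n; m≡m%n+[m/n]*n; m/n*n≤m)
open import Data.Nat.Divisibility using (_∣0; ∣-refl; ∣m∣n⇒∣m+n)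
open import Data.Product using (_,_; proj₂)
open import Data.Sign using (Sign) renaming (+ to plus; - to minus)
open import Data.Unit.Polymorphic using (⊤)
open import Data.Vec using ([]; _∷_; replicate; _++_; drop)
open import Relation.Binary.PropositionalEquality as ≡ using (_≡_; refl)
open import Algebra.Bundles using (AbelianGroup; Group)

[1+d]*k<n⇒1+d+k≤n : ∀ {d k n} → 0 < k → suc d * k < n → suc d + k ≤ n
[1+d]*k<n⇒1+d+k≤n {d} {suc k-1} _ 1+d*k<n = ℕ.≤-trans (s≤s d+k≤k+d*k) 1+d*k<n
  where
  d+k≤k+d*k : d + suc k-1 ≤ suc k-1 + d * suc k-1
  d+k≤k+d*k = ℕ.≤-trans (ℕ.+-monoˡ-≤ (suc k-1) (ℕ.m≤m*n d (suc k-1)))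
                        (ℕ.≤-reflexive (ℕ.+-comm (d * suc k-1) (suc k-1)))

0<n⇒∃[d]d*k<n≤[1+d]*k : ∀ {k n} → 0 < k → 0 < n → ∃ λ d → d * k < n × n ≤ suc d * k
0<n⇒∃[d]d*k<n≤[1+d]*k {suc k-1} {suc n-1} _ _ = d , s≤s (m/n*n≤m n-1 k) , n-1<k+d*k
  where
  k d : ℕ
  k = suc k-1
  d = n-1 / k
  n-1<k+d*k : n-1 < k + d * k
  n-1<k+d*k = ≡.subst (_< k + d * k) (≡.sym (m≡m%n+[m/n]*n n-1 k)) (ℕ.+-monoˡ-< (d * k) (m%n<n n-1 k))

2*n<k*[2*s+1] : ∀ {k n e s} → 0 < k → n ≤ e * k → e ≤ s → 2 * n < k * (2 * s + 1)
2*n<k*[2*s+1] {k} {n} {e} {s} 0<k n≤e*k e≤s = begin-strict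
  2 * n          ≤⟨ ℕ.*-monoʳ-≤ 2 (ℕ.≤-trans n≤e*k (ℕ.*-monoˡ-≤ k e≤s)) ⟩
  2 * (s * k)    <⟨ ℕ.m<m+n (2 * (s * k)) 0<k ⟩
  2 * (s * k) + k ≡⟨ solve 2 (λ s k → con 2 :* (s :* k) :+ k := k :* (con 2 :* s :+ con 1)) ≡.refl s k ⟩
  k * (2 * s + 1) ∎
  where
  open ℕ.≤-Reasoning
  open +-*-Solver

ones : ∀ {n} → Cube n
ones = replicate _ plus

minusCount≡0⇒≡ones : ∀ {n} (x : Cube n) → minusCount x ≡ 0 → x ≡ ones
minusCount≡0⇒≡ones [] _ = refl
minusCount≡0⇒≡ones (plus ∷ x) eq = ≡.cong (plus ∷_) (minusCount≡0⇒≡ones x eq)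

minusCount-ones : ∀ {n} → minusCount (ones {n}) ≡ 0
minusCount-ones {zero} = refl
minusCount-ones {suc n} = minusCount-ones {n}

minusCount-plus++ : ∀ j {m} (z : Cube m) → minusCount (replicate j plus ++ z) ≡ minusCount z
minusCount-plus++ zero z = refl
minusCount-plus++ (suc j) z = minusCount-plus++ j z

minusCount-minus++ : ∀ j {m} (z : Cube m) → minusCount (replicate j minus ++ z) ≡ j + minusCount z
minusCount-minus++ zero z = refl
minusCount-minus++ (suc j) z = ≡.cong suc (minusCount-minus++ j z)

setPrefix : Sign → ℕ → ∀ {n} → Cube n → Cube n
setPrefix s zero x = x
setPrefix s (suc j) [] = []
setPrefix s (suc j) (_ ∷ x) = s ∷ setPrefix s j x

setPrefix-ones : ∀ j {n} → setPrefix plus j (ones {n}) ≡ ones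
setPrefix-ones zero = refl
setPrefix-ones (suc j) {zero} = refl
setPrefix-ones (suc j) {suc n} = ≡.cong (plus ∷_) (setPrefix-ones j)

setPrefix-++ : ∀ j {m} s (x : Cube (j + m)) → setPrefix s j x ≡ replicate j s ++ drop j x
setPrefix-++ zero s x = refl
setPrefix-++ (suc j) s (_ ∷ x) = ≡.cong (s ∷_) (setPrefix-++ j s x)

lift : ∀ {n} → (Cube n → Cube n) → Cube (suc n) → Cube (suc n)
lift π (s ∷ x) = s ∷ π x

swap : ∀ {n} → Cube (suc (suc n)) → Cube (suc (suc n))
swap (s ∷ t ∷ x) = t ∷ s ∷ x

moveHeadTo : ℕ → ∀ {n} → Cube n → Cube n
moveHeadTo zero = id
moveHeadTo (suc i) {zero} = id
moveHeadTo (suc i) {suc zero} = id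
moveHeadTo (suc i) {suc (suc n)} = lift (moveHeadTo i) ∘ swap

moveToHead : ℕ → ∀ {n} → Cube n → Cube n
moveToHead zero = id
moveToHead (suc i) {zero} = id
moveToHead (suc i) {suc zero} = id
moveToHead (suc i) {suc (suc n)} = swap ∘ lift (moveToHead i)

moveToHead-setPrefix : ∀ j {n} t s (y : Cube n) → j ≤ n →
                       moveToHead j (setPrefix t j (moveHeadTo j (s ∷ y))) ≡ s ∷ setPrefix t j y
moveToHead-setPrefix zero t s y _ = refl
moveToHead-setPrefix (suc j) t s (b ∷ y) (s≤s j≤n)
  rewrite moveToHead-setPrefix j t s y j≤n = refl

module CubeFunctions {g ℓ} (G : AbelianGroup g ℓ) where
  open AbelianGroup G renaming (Carrier to A; refl to ≈-refl)
  open Group group using (_//_)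
  open import Algebra.Properties.AbelianGroup G
    using (⁻¹-∙-comm; ε⁻¹≈ε; ⁻¹-involutive; x∙y⁻¹≈ε⇒x≈y; x≈y⇒x∙y⁻¹≈ε)
  open import Algebra.Properties.CommutativeSemigroup commutativeSemigroup using (interchange)
  open import Algebra.Definitions.RawMonoid rawMonoid using () renaming (_×_ to _·_)
  open import Relation.Binary.Reasoning.Setoid setoid

  ∙≈ε : ∀ {x y} → x ≈ ε → y ≈ ε → x ∙ y ≈ ε
  ∙≈ε p q = trans (∙-cong p q) (identityˡ ε)

  //≈ε : ∀ {x y} → x ≈ ε → y ≈ ε → x // y ≈ ε
  //≈ε p q = ∙≈ε p (trans (⁻¹-cong q) ε⁻¹≈ε)

  //-cong : ∀ {x y u v} → x ≈ y → u ≈ v → x // u ≈ y // v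
  //-cong p q = ∙-cong p (⁻¹-cong q)

  //-∙-interchange : ∀ a b c d → (a ∙ b) // (c ∙ d) ≈ (a // c) ∙ (b // d)
  //-∙-interchange a b c d = trans (∙-congˡ (sym (⁻¹-∙-comm c d))) (interchange a b (c ⁻¹) (d ⁻¹))

  //-//-interchange : ∀ a b c d → (a // b) // (c // d) ≈ (a // c) // (b // d)
  //-//-interchange a b c d =
    trans (//-∙-interchange a (b ⁻¹) c (d ⁻¹)) (∙-congˡ (⁻¹-∙-comm b (d ⁻¹)))

  //-telescope : ∀ a b c → a // c ≈ (a // b) ∙ (b // c)
  //-telescope a b c = begin
    a // c                   ≈⟨ identityʳ (a // c) ⟨
    (a // c) ∙ ε             ≈⟨ ∙-congˡ (inverseˡ b) ⟨
    (a ∙ c ⁻¹) ∙ (b ⁻¹ ∙ b)  ≈⟨ interchange a (c ⁻¹) (b ⁻¹) b ⟩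
    (a // b) ∙ (c ⁻¹ ∙ b)    ≈⟨ ∙-congˡ (comm (c ⁻¹) b) ⟩
    (a // b) ∙ (b // c)      ∎

  x//[x//y]≈y : ∀ a b → a // (a // b) ≈ b
  x//[x//y]≈y a b = begin
    a ∙ (a ∙ b ⁻¹) ⁻¹       ≈⟨ ∙-congˡ (⁻¹-∙-comm a (b ⁻¹)) ⟨
    a ∙ (a ⁻¹ ∙ b ⁻¹ ⁻¹)    ≈⟨ assoc a (a ⁻¹) (b ⁻¹ ⁻¹) ⟨
    (a ∙ a ⁻¹) ∙ b ⁻¹ ⁻¹    ≈⟨ ∙-cong (inverseʳ a) (⁻¹-involutive b) ⟩
    ε ∙ b                   ≈⟨ identityˡ b ⟩
    b                       ∎

  Fun : ℕ → Set g
  Fun n = Cube n → A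

  Δ : ∀ {n} → Fun (suc n) → Fun n
  Δ f y = f (plus ∷ y) // f (minus ∷ y)

  HeadIndependent : ∀ {n} → Fun (suc n) → Set ℓ
  HeadIndependent f = ∀ y → f (plus ∷ y) ≈ f (minus ∷ y)

  -- Writing f (s ∷ y) = f₀ y + s f₁ y, the last
  -- clause bounds the degrees of f₀ + f₁ and 2 f₁, so without 2-torsion Deg< e f says that
  -- the Fourier–Walsh coefficients of f of order ≥ e vanish.
  Deg< : ℕ → ∀ {n} → Fun n → Set ℓ
  Deg< zero f = ∀ x → f x ≈ ε
  Deg< (suc e) {zero} f = ⊤
  Deg< (suc e) {suc n} f = Deg< (suc e) (λ y → f (plus ∷ y)) × Deg< e (Δ f)

  Deg<-resp : ∀ e {n} {f h : Fun n} → (∀ x → f x ≈ h x) → Deg< e f → Deg< e h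
  Deg<-resp zero f≈h d x = trans (sym (f≈h x)) (d x)
  Deg<-resp (suc e) {zero} f≈h d = _
  Deg<-resp (suc e) {suc n} f≈h (d₊ , dΔ) =
    Deg<-resp (suc e) (λ y → f≈h (plus ∷ y)) d₊ ,
    Deg<-resp e (λ y → //-cong (f≈h (plus ∷ y)) (f≈h (minus ∷ y))) dΔ

  Deg<-ε : ∀ e {n} {f : Fun n} → (∀ x → f x ≈ ε) → Deg< e f
  Deg<-ε zero f≈ε = f≈ε
  Deg<-ε (suc e) {zero} f≈ε = _
  Deg<-ε (suc e) {suc n} f≈ε =
    Deg<-ε (suc e) (λ y → f≈ε (plus ∷ y)) ,
    Deg<-ε e (λ y → //≈ε (f≈ε (plus ∷ y)) (f≈ε (minus ∷ y)))

  Deg<-suc : ∀ e {n} {f : Fun n} → Deg< e f → Deg< (suc e) f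
  Deg<-suc e {zero} d = _
  Deg<-suc zero {suc n} d =
    Deg<-suc zero (λ y → d (plus ∷ y)) , λ y → //≈ε (d (plus ∷ y)) (d (minus ∷ y))
  Deg<-suc (suc e) {suc n} (d₊ , dΔ) = Deg<-suc (suc e) d₊ , Deg<-suc e dΔ

  Deg<-∙ : ∀ e {n} {f h : Fun n} → Deg< e f → Deg< e h → Deg< e (λ x → f x ∙ h x)
  Deg<-∙ zero df dh x = ∙≈ε (df x) (dh x)
  Deg<-∙ (suc e) {zero} df dh = _
  Deg<-∙ (suc e) {suc n} {f} {h} (df₊ , dfΔ) (dh₊ , dhΔ) =
    Deg<-∙ (suc e) df₊ dh₊ ,
    Deg<-resp e (λ y → sym (//-∙-interchange (f (plus ∷ y)) (h (plus ∷ y))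
                                             (f (minus ∷ y)) (h (minus ∷ y))))
      (Deg<-∙ e dfΔ dhΔ)

  Deg<-⁻¹ : ∀ e {n} {f : Fun n} → Deg< e f → Deg< e (λ x → f x ⁻¹)
  Deg<-⁻¹ zero d x = trans (⁻¹-cong (d x)) ε⁻¹≈ε
  Deg<-⁻¹ (suc e) {zero} d = _
  Deg<-⁻¹ (suc e) {suc n} {f} (d₊ , dΔ) =
    Deg<-⁻¹ (suc e) d₊ ,
    Deg<-resp e (λ y → sym (⁻¹-∙-comm (f (plus ∷ y)) (f (minus ∷ y) ⁻¹))) (Deg<-⁻¹ e dΔ)

  Deg<-// : ∀ e {n} {f h : Fun n} → Deg< e f → Deg< e h → Deg< e (λ x → f x // h x)
  Deg<-// e df dh = Deg<-∙ e df (Deg<-⁻¹ e dh)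

  Deg<-minus∷ : ∀ e {n} {f : Fun (suc n)} → Deg< e f → Deg< e (λ y → f (minus ∷ y))
  Deg<-minus∷ zero d y = d (minus ∷ y)
  Deg<-minus∷ (suc e) {f = f} (d₊ , dΔ) =
    Deg<-resp (suc e) (λ y → x//[x//y]≈y (f (plus ∷ y)) (f (minus ∷ y)))
      (Deg<-// (suc e) d₊ (Deg<-suc e dΔ))

  Deg<-plus++ : ∀ j {m} e {f : Fun (j + m)} → Deg< e f → Deg< e (λ z → f (replicate j plus ++ z))
  Deg<-plus++ zero e d = d
  Deg<-plus++ (suc j) zero d z = d _
  Deg<-plus++ (suc j) (suc e) (d₊ , _) = Deg<-plus++ j (suc e) d₊

  blockDifference : ∀ j {m} → Fun (j + m) → Fun m
  blockDifference j f z = f (replicate j plus ++ z) // f (replicate j minus ++ z)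

  Deg<-blockDifference : ∀ j {m} e {f : Fun (j + m)} → Deg< (suc e) f → Deg< e (blockDifference j f)
  Deg<-blockDifference zero e {f} _ = Deg<-ε e (λ z → inverseʳ (f z))
  Deg<-blockDifference (suc j) e {f} (d₊ , dΔ) =
    Deg<-resp e
      (λ z → sym (//-telescope (f (plus ∷ replicate j plus ++ z)) (f (minus ∷ replicate j plus ++ z))
                               (f (minus ∷ replicate j minus ++ z))))
      (Deg<-∙ e (Deg<-plus++ j e dΔ)
                (Deg<-blockDifference j e (Deg<-minus∷ (suc e) {f = f} (d₊ , dΔ))))

  Deg<1⇒headIndependent : ∀ {n} {f : Fun (suc n)} → Deg< 1 f → HeadIndependent f
  Deg<1⇒headIndependent (_ , dΔ) y = x∙y⁻¹≈ε⇒x≈y _ _ (dΔ y)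

  -- Stands in for the coordinate permutations: only these two properties of them are used.
  record Admissible {n} (π : Cube n → Cube n) : Set (g ⊔ ℓ) where
    field
      Deg<-∘ : ∀ {e} {f : Fun n} → Deg< e f → Deg< e (f ∘ π)
      minusCount-∘ : ∀ x → minusCount (π x) ≡ minusCount x

  open Admissible

  Admissible-ones : ∀ {n} {π : Cube n → Cube n} → Admissible π → π ones ≡ ones
  Admissible-ones {n} {π} adm =
    minusCount≡0⇒≡ones (π ones) (≡.trans (minusCount-∘ adm ones) (minusCount-ones {n}))

  id-admissible : ∀ {n} → Admissible {n} id
  id-admissible = record { Deg<-∘ = id ; minusCount-∘ = λ _ → refl }

  ∘-admissible : ∀ {n} {π σ : Cube n → Cube n} → Admissible π → Admissible σ → Admissible (π ∘ σ)
  ∘-admissible {σ = σ} adm₁ adm₂ = record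
    { Deg<-∘ = Deg<-∘ adm₂ ∘ Deg<-∘ adm₁
    ; minusCount-∘ = λ x → ≡.trans (minusCount-∘ adm₁ (σ x)) (minusCount-∘ adm₂ x)
    }

  lift-admissible : ∀ {n} {π : Cube n → Cube n} → Admissible π → Admissible (lift π)
  lift-admissible {n} {π} adm = record { Deg<-∘ = deg ; minusCount-∘ = count }
    where
    deg : ∀ {e} {f : Fun (suc n)} → Deg< e f → Deg< e (f ∘ lift π)
    deg {zero} d (s ∷ x) = d (s ∷ π x)
    deg {suc e} (d₊ , dΔ) = Deg<-∘ adm d₊ , Deg<-∘ adm dΔ
    count : ∀ x → minusCount (lift π x) ≡ minusCount x
    count (plus ∷ x) = minusCount-∘ adm x
    count (minus ∷ x) = ≡.cong suc (minusCount-∘ adm x)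

  swap-admissible : ∀ {n} → Admissible {suc (suc n)} swap
  swap-admissible {n} = record { Deg<-∘ = deg ; minusCount-∘ = count }
    where
    deg : ∀ {e} {f : Fun (suc (suc n))} → Deg< e f → Deg< e (f ∘ swap)
    deg {zero} d x = d (swap x)
    deg {suc zero} {f} ((d₊₊ , d₊Δ) , dΔ) = (d₊₊ , λ y → dΔ (plus ∷ y)) , dΔswap
      where
      -- f is constant; the chain joins (−,+,y) to (−,−,y) by single coordinate flips.
      dΔswap : ∀ z → f (swap (plus ∷ z)) // f (swap (minus ∷ z)) ≈ ε
      dΔswap (plus ∷ y) = d₊Δ y
      dΔswap (minus ∷ y) = x≈y⇒x∙y⁻¹≈ε (begin
        f (minus ∷ plus ∷ y)  ≈⟨ x∙y⁻¹≈ε⇒x≈y _ _ (dΔ (plus ∷ y)) ⟨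
        f (plus ∷ plus ∷ y)   ≈⟨ x∙y⁻¹≈ε⇒x≈y _ _ (d₊Δ y) ⟩
        f (plus ∷ minus ∷ y)  ≈⟨ x∙y⁻¹≈ε⇒x≈y _ _ (dΔ (minus ∷ y)) ⟩
        f (minus ∷ minus ∷ y) ∎)
    deg {suc (suc e)} ((d₊₊ , d₊Δ) , (dΔ₊ , dΔΔ)) =
      (d₊₊ , dΔ₊) , (d₊Δ , Deg<-resp e (λ _ → //-//-interchange _ _ _ _) dΔΔ)
    count : ∀ x → minusCount (swap x) ≡ minusCount x
    count (plus ∷ plus ∷ x) = refl
    count (plus ∷ minus ∷ x) = refl
    count (minus ∷ plus ∷ x) = refl
    count (minus ∷ minus ∷ x) = refl

  moveHeadTo-admissible : ∀ i {n} → Admissible {n} (moveHeadTo i)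
  moveHeadTo-admissible zero = id-admissible
  moveHeadTo-admissible (suc i) {zero} = id-admissible
  moveHeadTo-admissible (suc i) {suc zero} = id-admissible
  moveHeadTo-admissible (suc i) {suc (suc n)} =
    ∘-admissible (lift-admissible (moveHeadTo-admissible i)) swap-admissible

  moveToHead-admissible : ∀ i {n} → Admissible {n} (moveToHead i)
  moveToHead-admissible zero = id-admissible
  moveToHead-admissible (suc i) {zero} = id-admissible
  moveToHead-admissible (suc i) {suc zero} = id-admissible
  moveToHead-admissible (suc i) {suc (suc n)} =
    ∘-admissible swap-admissible (lift-admissible (moveToHead-admissible i))

  Admissibly : ∀ {p n} → (Fun n → Set p) → Fun n → Set (g ⊔ ℓ ⊔ p)
  Admissibly P f = ∀ {π} → Admissible π → P (f ∘ π)

  HasConstantSlope : ∀ {n} → Fun (suc n) → Set ℓ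
  HasConstantSlope f = ∀ y → Δ f y ≈ Δ f ones

  BlockInvariant : ℕ → ∀ {n} → Fun n → Set ℓ
  BlockInvariant j f = ∀ x → f (setPrefix plus j x) ≈ f (setPrefix minus j x)

  headIndependent-∷ : ∀ {n} {f : Fun (suc n)} → HeadIndependent f → ∀ s y → f (s ∷ y) ≈ f (plus ∷ y)
  headIndependent-∷ hi plus y = ≈-refl
  headIndependent-∷ hi minus y = sym (hi y)

  -- Conjugating by lift π ∘ swap turns independence of the first coordinate into
  -- independence of the second one.
  admissiblyHeadIndependent⇒constant : ∀ {n} {f : Fun (suc n)} →
                                       Admissibly HeadIndependent f → ∀ x → f x ≈ f ones
  admissiblyHeadIndependent⇒constant {zero} {f} hi (s ∷ []) =
    headIndependent-∷ {f = f} (hi id-admissible) s []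
  admissiblyHeadIndependent⇒constant {suc n} {f} hi (s ∷ y) =
    trans (headIndependent-∷ {f = f} (hi id-admissible) s y) (admissiblyHeadIndependent⇒constant hi₊ y)
    where
    hi₊ : Admissibly HeadIndependent (λ z → f (plus ∷ z))
    hi₊ adm z = hi (∘-admissible (lift-admissible adm) swap-admissible) (plus ∷ z)

  Deg<1⇒constant : ∀ {n} {f : Fun n} → Deg< 1 f → ∀ x → f x ≈ f ones
  Deg<1⇒constant {zero} _ [] = ≈-refl
  Deg<1⇒constant {suc n} {f} d =
    admissiblyHeadIndependent⇒constant {f = f}
      (λ {π} adm → Deg<1⇒headIndependent {f = f ∘ π} (Deg<-∘ adm {f = f} d))

  Admissibly-BlockInvariant-∷ : ∀ j {n} (f : Fun (suc n)) → j ≤ n → Admissibly (BlockInvariant j) f →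
                                ∀ s → Admissibly (BlockInvariant j) (λ y → f (s ∷ y))
  Admissibly-BlockInvariant-∷ j f j≤n bi s {π} adm x =
    ≡.subst₂ (λ u v → f (lift π u) ≈ f (lift π v))
      (moveToHead-setPrefix j plus s x j≤n) (moveToHead-setPrefix j minus s x j≤n)
      (bi (∘-admissible (lift-admissible adm) (moveToHead-admissible j)) (moveHeadTo j (s ∷ x)))

  Admissibly-BlockInvariant-Δ : ∀ j {n} (f : Fun (suc n)) → j ≤ n →
                                Admissibly (BlockInvariant j) f → Admissibly (BlockInvariant j) (Δ f)
  Admissibly-BlockInvariant-Δ j f j≤n bi adm x =
    //-cong (Admissibly-BlockInvariant-∷ j f j≤n bi plus adm x)
            (Admissibly-BlockInvariant-∷ j f j≤n bi minus adm x)

  -- The points (+,−,M) and (−,+,M), with M having its first j coordinates −, both lie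
  -- in the class of ones under flips of a block of j + 1 coordinates.
  slope-swap : ∀ j {n} (h : Fun (suc (suc n))) →
               BlockInvariant (suc j) (λ y → h (plus ∷ y)) →
               BlockInvariant (suc j) (λ y → h (swap (plus ∷ y))) →
               HasConstantSlope h → HasConstantSlope (h ∘ swap) → Δ (h ∘ swap) ones ≈ Δ h ones
  slope-swap j {n} h bi₁ bi₂ cs₁ cs₂ = begin
    Δ (h ∘ swap) ones                              ≈⟨ cs₂ (minus ∷ M) ⟨
    h (minus ∷ plus ∷ M) // h (minus ∷ minus ∷ M)  ≈⟨ //-cong (trans (sym ones≈−+) ones≈+−) ≈-refl ⟩
    h (plus ∷ minus ∷ M) // h (minus ∷ minus ∷ M)  ≈⟨ cs₁ (minus ∷ M) ⟩
    Δ h ones                                       ∎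
    where
    M : Cube n
    M = setPrefix minus j ones
    ones≈+− : h ones ≈ h (plus ∷ minus ∷ M)
    ones≈+− = ≡.subst (λ u → h (plus ∷ plus ∷ u) ≈ h (plus ∷ minus ∷ M))
                      (setPrefix-ones j) (bi₁ ones)
    ones≈−+ : h ones ≈ h (minus ∷ plus ∷ M)
    ones≈−+ = ≡.subst (λ u → h (plus ∷ plus ∷ u) ≈ h (minus ∷ plus ∷ M))
                      (setPrefix-ones j) (bi₂ ones)

  prefixFlip : ∀ {m} (h : Fun (suc m)) {a} → (∀ i y → Δ (h ∘ moveHeadTo i) y ≈ a) →
               ∀ j → j ≤ suc m → ∀ x → h (setPrefix plus j x) // h (setPrefix minus j x) ≈ j · a
  prefixFlip h slopes zero _ x = inverseʳ _
  prefixFlip h slopes (suc zero) _ (_ ∷ x) = trans (slopes 0 x) (sym (identityʳ _))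
  prefixFlip {zero} h slopes (suc (suc j)) (s≤s ()) x
  prefixFlip {suc m} h {a} slopes (suc (suc j)) (s≤s j≤m) (_ ∷ x) = begin
    h (plus ∷ P) // h (minus ∷ M)              ≈⟨ //-telescope _ (h (minus ∷ P)) _ ⟩
    Δ h P ∙ (h (minus ∷ P) // h (minus ∷ M))   ≈⟨ ∙-cong (slopes 0 P) (prefixFlip h₋ slopes₋ (suc j) j≤m x) ⟩
    a ∙ (suc j · a)                            ∎
    where
    P M : Cube (suc m)
    P = setPrefix plus (suc j) x
    M = setPrefix minus (suc j) x
    h₋ : Fun (suc m)
    h₋ z = h (minus ∷ z)
    slopes₋ : ∀ i y → Δ (h₋ ∘ moveHeadTo i) y ≈ a
    slopes₋ i y = slopes (suc i) (minus ∷ y)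

  admissibly-slope≈ε : ∀ {k n} (g : Fun (suc n)) → 0 < k → k ≤ n → (∀ a → k · a ≈ ε → a ≈ ε) →
                       Admissibly (BlockInvariant k) g → Admissibly HasConstantSlope g → Δ g ones ≈ ε
  admissibly-slope≈ε {suc j} {suc n} g _ k≤n torsionFree bi cs = torsionFree (Δ g ones) (begin
    suc j · Δ g ones                      ≈⟨ prefixFlip g slopeAlong (suc j) (ℕ.m≤n⇒m≤1+n k≤n) ones ⟨
    g (setPrefix plus (suc j) ones) // g (setPrefix minus (suc j) ones)
                                          ≈⟨ x≈y⇒x∙y⁻¹≈ε (bi id-admissible ones) ⟩
    ε                                     ∎)
    where
    tailInvariant : ∀ {σ} → Admissible σ → BlockInvariant (suc j) (λ y → g (σ (plus ∷ y)))
    tailInvariant {σ} adm =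
      Admissibly-BlockInvariant-∷ (suc j) (g ∘ σ) k≤n (λ adm′ → bi (∘-admissible adm adm′)) plus id-admissible
    slopeAlong : ∀ i y → Δ (g ∘ moveHeadTo i) y ≈ Δ g ones
    slopeAlong zero y = cs id-admissible y
    slopeAlong (suc i) y = begin
      Δ (g ∘ moveHeadTo (suc i)) y   ≈⟨ cs (moveHeadTo-admissible (suc i)) y ⟩
      Δ (h ∘ swap) ones              ≈⟨ slope-swap j h (tailInvariant σ-adm) (tailInvariant σswap-adm)
                                                       (cs σ-adm) (cs σswap-adm) ⟩
      Δ g (moveHeadTo i ones)        ≡⟨ ≡.cong (Δ g) (Admissible-ones (moveHeadTo-admissible i)) ⟩
      Δ g ones                       ∎
      where
      h : Fun (suc (suc n))
      h = g ∘ lift (moveHeadTo i)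
      σ-adm : Admissible (lift (moveHeadTo i))
      σ-adm = lift-admissible (moveHeadTo-admissible i)
      σswap-adm : Admissible (lift (moveHeadTo i) ∘ swap)
      σswap-adm = ∘-admissible σ-adm swap-admissible

  blockInvariant-++ : ∀ j {m} (f : Fun (j + m)) → (∀ z → blockDifference j f z ≈ ε) → BlockInvariant j f
  blockInvariant-++ j f f≈ε x rewrite setPrefix-++ j plus x | setPrefix-++ j minus x =
    x∙y⁻¹≈ε⇒x≈y _ _ (f≈ε (drop j x))

  module _ {k} (0<k : 0 < k) (torsionFree : ∀ a → k · a ≈ ε → a ≈ ε) where

    blockInvariant⇒constant : ∀ d {n} (f : Fun n) → d + k ≤ n → Deg< (suc d) f →
                              Admissibly (BlockInvariant k) f → ∀ x → f x ≈ f ones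
    blockInvariant⇒constant zero f _ deg _ = Deg<1⇒constant {f = f} deg
    blockInvariant⇒constant (suc d) {suc n} f (s≤s d+k≤n) deg bi =
      admissiblyHeadIndependent⇒constant {f = f} headIndependent
      where
      k≤n : k ≤ n
      k≤n = ℕ.m+n≤o⇒n≤o d d+k≤n
      constantSlope : Admissibly HasConstantSlope f
      constantSlope {π} adm =
        blockInvariant⇒constant d (Δ (f ∘ π)) d+k≤n (proj₂ (Deg<-∘ adm {f = f} deg))
          (Admissibly-BlockInvariant-Δ k (f ∘ π) k≤n (λ adm′ → bi (∘-admissible adm adm′)))
      headIndependent : Admissibly HeadIndependent f
      headIndependent {π} adm y = x∙y⁻¹≈ε⇒x≈y _ _ (trans (constantSlope adm y)
        (admissibly-slope≈ε (f ∘ π) 0<k k≤n torsionFree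
          (λ adm′ → bi (∘-admissible adm adm′)) (λ adm′ → constantSlope (∘-admissible adm adm′))))

    VanishesOnW : ∀ {n} → Fun n → Set ℓ
    VanishesOnW f = ∀ x → InW k x → f x ≈ ε

    ones∈W : ∀ {n} → InW k (ones {n})
    ones∈W {n} = ≡.subst (k ∣_) (≡.sym (minusCount-ones {n})) (k ∣0)

    VanishesOnW-∘ : ∀ {n} {f : Fun n} {π} → VanishesOnW f → Admissible π → VanishesOnW (f ∘ π)
    VanishesOnW-∘ {π = π} w adm x x∈W = w (π x) (≡.subst (k ∣_) (≡.sym (minusCount-∘ adm x)) x∈W)

    VanishesOnW-blockDifference : ∀ {m} {f : Fun (k + m)} → VanishesOnW f → VanishesOnW (blockDifference k f)
    VanishesOnW-blockDifference w z z∈W = //≈ε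
      (w _ (≡.subst (k ∣_) (≡.sym (minusCount-plus++ k z)) z∈W))
      (w _ (≡.subst (k ∣_) (≡.sym (minusCount-minus++ k z)) (∣m∣n⇒∣m+n ∣-refl z∈W)))

    vanishesOnW⇒≈ε : ∀ d {n} (f : Fun n) → d * k < n → Deg< (suc d) f → VanishesOnW f → ∀ x → f x ≈ ε
    vanishesOnW⇒≈ε zero {n} f _ deg w x = trans (Deg<1⇒constant {f = f} deg x) (w ones (ones∈W {n}))
    vanishesOnW⇒≈ε (suc d) f 1+d*k<n deg w x
      with m , refl ← ℕ.m≤n⇒∃[o]m+o≡n (ℕ.m+n≤o⇒m≤o k (ℕ.<⇒≤ 1+d*k<n)) =
      trans (blockInvariant⇒constant (suc d) f ([1+d]*k<n⇒1+d+k≤n 0<k 1+d*k<n) deg bi x)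
            (w ones (ones∈W {k + m}))
      where
      bi : Admissibly (BlockInvariant k) f
      bi {π} adm = blockInvariant-++ k (f ∘ π)
        (vanishesOnW⇒≈ε d (blockDifference k (f ∘ π)) (ℕ.+-cancelˡ-< k _ _ 1+d*k<n)
          (Deg<-blockDifference k (suc d) (Deg<-∘ adm {f = f} deg))
          (VanishesOnW-blockDifference (VanishesOnW-∘ w adm)))

module FourierWalsh {r ℓr m ℓm} (R : CommutativeRing r ℓr) (X : LeftModule (CommutativeRing.ring R) m ℓm) where
  open CommutativeRing R using (1#; *-comm; -‿inverseˡ) renaming (_*_ to _*ᴿ_; -_ to -ᴿ_)
  open LeftModule X
  open CubeFunctions +ᴹ-abelianGroup
  open Group (AbelianGroup.group +ᴹ-abelianGroup) using (_//_)
  open import Algebra.Properties.AbelianGroup +ᴹ-abelianGroup using (inverseˡ-unique; ⁻¹-involutive; ⁻¹-∙-comm)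
  open import Algebra.Definitions.RawMonoid (AbelianGroup.rawMonoid +ᴹ-abelianGroup) using () renaming (_×_ to _·_)
  open import Relation.Binary.Reasoning.Setoid ≈ᴹ-setoid

  private
    Σ : ∀ {n} → (Sub n → Carrierᴹ) → Carrierᴹ
    Σ = sumSub R X

  sumSub-cong : ∀ {n} {g h : Sub n → Carrierᴹ} → (∀ S → g S ≈ᴹ h S) → Σ g ≈ᴹ Σ h
  sumSub-cong {zero} g≈h = g≈h []
  sumSub-cong {suc n} g≈h = +ᴹ-cong (sumSub-cong (g≈h ∘ (false ∷_))) (sumSub-cong (g≈h ∘ (true ∷_)))

  sumSub-≈0 : ∀ {n} {g : Sub n → Carrierᴹ} → (∀ S → g S ≈ᴹ 0ᴹ) → Σ g ≈ᴹ 0ᴹ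
  sumSub-≈0 {zero} g≈0 = g≈0 []
  sumSub-≈0 {suc n} g≈0 = ∙≈ε (sumSub-≈0 (g≈0 ∘ (false ∷_))) (sumSub-≈0 (g≈0 ∘ (true ∷_)))

  sumSub-+ : ∀ {n} (g h : Sub n → Carrierᴹ) → Σ (λ S → g S +ᴹ h S) ≈ᴹ Σ g +ᴹ Σ h
  sumSub-+ {zero} g h = ≈ᴹ-refl
  sumSub-+ {suc n} g h = ≈ᴹ-trans
    (+ᴹ-cong (sumSub-+ (g ∘ (false ∷_)) (h ∘ (false ∷_))) (sumSub-+ (g ∘ (true ∷_)) (h ∘ (true ∷_))))
    (interchange _ _ _ _)
    where open import Algebra.Properties.CommutativeSemigroup (AbelianGroup.commutativeSemigroup +ᴹ-abelianGroup)

  sumSub-neg : ∀ {n} (g : Sub n → Carrierᴹ) → Σ (λ S → -ᴹ g S) ≈ᴹ -ᴹ Σ g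
  sumSub-neg {zero} g = ≈ᴹ-refl
  sumSub-neg {suc n} g =
    ≈ᴹ-trans (+ᴹ-cong (sumSub-neg (g ∘ (false ∷_))) (sumSub-neg (g ∘ (true ∷_)))) (⁻¹-∙-comm _ _)

  neg-*ₗ : ∀ a v → (-ᴿ a) *ₗ v ≈ᴹ -ᴹ (a *ₗ v)
  neg-*ₗ a v = inverseˡ-unique _ _
    (≈ᴹ-trans (≈ᴹ-sym (*ₗ-distribʳ v (-ᴿ a) a)) (≈ᴹ-trans (*ₗ-congʳ (-‿inverseˡ a)) (*ₗ-zeroˡ v)))

  module _ {n} {f : Cube (suc n) → Carrierᴹ} {c : Sub (suc n) → Carrierᴹ} (fw : IsFourierWalsh R X f c) where
    private
      even odd : Cube n → Carrierᴹ
      even y = Σ (λ S → chi R y S *ₗ c (false ∷ S))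
      odd y = Σ (λ S → chi R y S *ₗ c (true ∷ S))

      sum-*ₗ-+ : ∀ (y : Cube n) (c₁ c₂ : Sub n → Carrierᴹ) →
                 Σ (λ S → chi R y S *ₗ c₁ S) +ᴹ Σ (λ S → chi R y S *ₗ c₂ S) ≈ᴹ
                 Σ (λ S → chi R y S *ₗ (c₁ S +ᴹ c₂ S))
      sum-*ₗ-+ y c₁ c₂ = ≈ᴹ-trans (≈ᴹ-sym (sumSub-+ (λ S → chi R y S *ₗ c₁ S) (λ S → chi R y S *ₗ c₂ S)))
        (sumSub-cong (λ S → ≈ᴹ-sym (*ₗ-distribˡ (chi R y S) (c₁ S) (c₂ S))))

      f-minus : ∀ y → f (minus ∷ y) ≈ᴹ even y +ᴹ -ᴹ odd y
      f-minus y = ≈ᴹ-trans (fw (minus ∷ y))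
        (+ᴹ-cong ≈ᴹ-refl (≈ᴹ-trans (sumSub-cong (λ S → neg-*ₗ (chi R y S) (c (true ∷ S))))
                                   (sumSub-neg (λ S → chi R y S *ₗ c (true ∷ S)))))

    IsFourierWalsh-plus∷ : IsFourierWalsh R X (λ y → f (plus ∷ y)) (λ S → c (false ∷ S) +ᴹ c (true ∷ S))
    IsFourierWalsh-plus∷ y = ≈ᴹ-trans (fw (plus ∷ y)) (sum-*ₗ-+ y _ _)

    IsFourierWalsh-Δ : IsFourierWalsh R X (Δ f) (λ S → c (true ∷ S) +ᴹ c (true ∷ S))
    IsFourierWalsh-Δ y = begin
      f (plus ∷ y) // f (minus ∷ y)                      ≈⟨ //-cong (fw (plus ∷ y)) (f-minus y) ⟩
      (even y +ᴹ odd y) // (even y +ᴹ -ᴹ odd y)          ≈⟨ //-∙-interchange _ _ _ _ ⟩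
      (even y // even y) +ᴹ (odd y // -ᴹ odd y)
                          ≈⟨ +ᴹ-cong (-ᴹ‿inverseʳ _) (+ᴹ-cong ≈ᴹ-refl (⁻¹-involutive _)) ⟩
      0ᴹ +ᴹ (odd y +ᴹ odd y)                             ≈⟨ +ᴹ-identityˡ _ ⟩
      odd y +ᴹ odd y                                     ≈⟨ sum-*ₗ-+ y _ _ ⟩
      Σ (λ S → chi R y S *ₗ (c (true ∷ S) +ᴹ c (true ∷ S))) ∎

  Deg<-fourierWalsh : ∀ e {n} {f : Cube n → Carrierᴹ} {c} → IsFourierWalsh R X f c →
                      (∀ S → e ≤ card S → c S ≈ᴹ 0ᴹ) → Deg< e f
  Deg<-fourierWalsh zero {c = c} fw c≈0 x =
    ≈ᴹ-trans (fw x)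
      (sumSub-≈0 {g = λ S → chi R x S *ₗ c S} (λ S → ≈ᴹ-trans (*ₗ-congˡ (c≈0 S z≤n)) (*ₗ-zeroʳ _)))
  Deg<-fourierWalsh (suc e) {zero} fw c≈0 = _
  Deg<-fourierWalsh (suc e) {suc n} {c = c} fw c≈0 =
    Deg<-fourierWalsh (suc e) (IsFourierWalsh-plus∷ {c = c} fw)
      (λ S e<|S| → ∙≈ε (c≈0 (false ∷ S) e<|S|) (c≈0 (true ∷ S) (ℕ.m≤n⇒m≤1+n e<|S|))) ,
    Deg<-fourierWalsh e (IsFourierWalsh-Δ {c = c} fw)
      (λ S e≤|S| → ∙≈ε (c≈0 (true ∷ S) (s≤s e≤|S|)) (c≈0 (true ∷ S) (s≤s e≤|S|)))

  natCast-*ₗ : ∀ j v → natCast R j *ₗ v ≈ᴹ j · v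
  natCast-*ₗ zero v = *ₗ-zeroˡ v
  natCast-*ₗ (suc j) v =
    ≈ᴹ-trans (*ₗ-distribʳ v 1# (natCast R j)) (+ᴹ-cong (*ₗ-identityˡ v) (natCast-*ₗ j v))

  charZero⇒torsionFree : IsField R → CharZero R → ∀ {k} → 0 < k → ∀ v → k · v ≈ᴹ 0ᴹ → v ≈ᴹ 0ᴹ
  charZero⇒torsionFree (_ , inverse) charZero {suc j} _ v k·v≈0
    with b , k*b≈1 ← inverse (natCast R (suc j)) (charZero j) = begin
    v                              ≈⟨ *ₗ-identityˡ v ⟨
    1# *ₗ v                        ≈⟨ *ₗ-congʳ (CommutativeRing.trans R (*-comm b _) k*b≈1) ⟨
    (b *ᴿ natCast R (suc j)) *ₗ v  ≈⟨ *ₗ-assoc b _ v ⟩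
    b *ₗ (natCast R (suc j) *ₗ v)  ≈⟨ *ₗ-congˡ (≈ᴹ-trans (natCast-*ₗ (suc j) v) k·v≈0) ⟩
    b *ₗ 0ᴹ                        ≈⟨ *ₗ-zeroʳ b ⟩
    0ᴹ                             ∎

corollary1p7 : ∀ {r ℓr m ℓm} (R : CommutativeRing r ℓr) → IsField R → CharZero R →
    (X : LeftModule (CommutativeRing.ring R) m ℓm) →
    (n : ℕ) → 1 ≤ n → (k : ℕ) → 2 ≤ k → 2 ∣ k →
    (f : Cube n → LeftModule.Carrierᴹ X) →
    (∃ λ c → IsFourierWalsh R X f c ×
      (∀ S → 2 * n < k * (2 * card S + 1) → LeftModule._≈ᴹ_ X (c S) (LeftModule.0ᴹ X))) →
    (∀ x → InW k x → LeftModule._≈ᴹ_ X (f x) (LeftModule.0ᴹ X)) →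
    ∀ x → LeftModule._≈ᴹ_ X (f x) (LeftModule.0ᴹ X)
corollary1p7 R isField charZero X n 0<n k (s≤s _) _ f (c , fw , c≈0) f≈0-on-W
  with d , d*k<n , n≤[1+d]*k ← 0<n⇒∃[d]d*k<n≤[1+d]*k z<s 0<n =
  vanishesOnW⇒≈ε 0<k (charZero⇒torsionFree isField charZero 0<k) d f d*k<n
    (Deg<-fourierWalsh (suc d) fw (λ S 1+d≤|S| → c≈0 S (2*n<k*[2*s+1] 0<k n≤[1+d]*k 1+d≤|S|)))
    f≈0-on-W
  where
  open FourierWalsh R X
  open CubeFunctions (LeftModule.+ᴹ-abelianGroup X)
  0<k : 0 < k
  0<k = z<s
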